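{- Let $Z\subseteq R\times C$ be a set of positions in an $m\times n$ array with row set $R$ and column set $C$, and let $k$ be a positive integer. For every set of rows $X\subseteq R$: $X\in I_k(Z)$ if and only if $X\cup r(Z)\in I_k(Z)$.
   Context: A file is a row or column. A set of files covers $Z$ if every position of $Z$ lies in one of its files; a cover is optimal if it has the minimum number of files among all covers of $Z$. $r(Z)$ denotes the set of rows that belong to some optimal cover of $Z$ (equivalently, the rows of the row-maximal optimal cover, an optimal cover containing all such rows). A $(k-1)$-cover of $Z$ is a cover consisting of exactly $k-1$ files, and a partial $(k-1)$-cover is a subset of a $(k-1)$-cover. $I_k(Z)$ is the family of all sets of rows $X\subseteq R$ that are partial $(k-1)$-covers of $Z$. -}

module Defs where

open import Data.Nat using (ℕ; _+_; _≤_; _∸_)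
open import Data.Fin using (Fin)
open import Data.Fin.Subset using (Subset; _∈_; _⊆_; ∣_∣)
open import Data.Bool using (Bool; true)
open import Data.Sum using (_⊎_)
open import Data.Product using (Σ; _×_; ∃₂)
open import Relation.Binary.PropositionalEquality using (_≡_)
open import Function.Bundles using (_⇔_)

Positions : ℕ → ℕ → Set
Positions m n = Fin m → Fin n → Bool

-- A set of files = a set of rows S together with a set of columns T.
-- It covers Z if every position of Z lies in one of its files.
IsCover : ∀ {m n} → Positions m n → Subset m → Subset n → Set
IsCover Z S T = ∀ i j → Z i j ≡ true → (i ∈ S) ⊎ (j ∈ T)

size : ∀ {m n} → Subset m → Subset n → ℕ
size S T = ∣ S ∣ + ∣ T ∣

IsOptimalCover : ∀ {m n} → Positions m n → Subset m → Subset n → Set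
IsOptimalCover {m} {n} Z S T =
  IsCover Z S T × (∀ (S′ : Subset m) (T′ : Subset n) → IsCover Z S′ T′ → size S T ≤ size S′ T′)

IsRZ : ∀ {m n} → Positions m n → Subset m → Set
IsRZ {m} {n} Z RZ = ∀ (i : Fin m) →
  (i ∈ RZ) ⇔ (∃₂ λ (S : Subset m) (T : Subset n) → IsOptimalCover Z S T × i ∈ S)

IsPartialCover : ∀ {m n} → Positions m n → ℕ → Subset m → Set
IsPartialCover {m} {n} Z c X =
  ∃₂ λ (S : Subset m) (T : Subset n) → IsCover Z S T × size S T ≡ c × X ⊆ S

InI : ∀ {m n} → Positions m n → ℕ → Subset m → Set
InI Z k X = IsPartialCover Z (k ∸ 1) X

{-# OPTIONS --safe #-}
-- If (S, T) is any cover and (S₀, T₀) an optimal one, then (S ∪ S₀, T ∩ T₀)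
-- and (S ∩ S₀, T ∪ T₀) are again covers, and their sizes add up to
-- size S T + size S₀ T₀. Optimality of (S₀, T₀) bounds the second size from
-- below, so the first cover is no larger than (S, T). Merging in, one row at a
-- time, optimal covers through the rows of r(Z) thus turns a cover whose rows
-- contain X into one, no larger, whose rows contain X ∪ r(Z); adding arbitrary
-- files brings it back to exactly k - 1 files.
module Submission where

open import Defs
open import Data.Nat using (ℕ; _≤_)
open import Data.Fin.Subset using (Subset; _∪_)
open import Function.Bundles using (_⇔_)

open import Algebra.Properties.CommutativeSemigroup using (interchange)
open import Data.Fin using (Fin)
open import Data.Fin.Subset using (_∩_; _∈_; _⊆_; ∣_∣; inside; outside)
open import Data.Fin.Subset.Properties
  using (_∈?_; ∣p∣≤n; ⊆-trans; s⊆s; out⊆; p⊆p∪q; q⊆p∪q; x∈p∪q⁺; x∈p∪q⁻; x∈p∩q⁺)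
open import Data.List using (List; []; _∷_; allFin)
open import Data.List.Membership.Propositional using () renaming (_∈_ to _∈ₗ_)
open import Data.List.Membership.Propositional.Properties using (∈-allFin)
open import Data.List.Relation.Unary.Any using (here; there)
open import Data.Nat using (suc; _+_; _∸_; z≤n; s≤s; _≤?_)
open import Data.Nat.Properties
open import Data.Product using (∃; ∃₂; _×_; _,_; proj₁)
open import Data.Sum using (inj₁; inj₂; [_,_]′)
open import Data.Vec using ([]; _∷_)
open import Function using (id; _∘_)
open import Function.Bundles using (mk⇔; Equivalence)
open import Relation.Binary.PropositionalEquality using (_≡_; refl; cong; cong₂; trans; module ≡-Reasoning)
open import Relation.Nullary using (yes; no; contradiction)

∣p∪q∣+∣p∩q∣≡∣p∣+∣q∣ : ∀ {n} (p q : Subset n) → ∣ p ∪ q ∣ + ∣ p ∩ q ∣ ≡ ∣ p ∣ + ∣ q ∣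
∣p∪q∣+∣p∩q∣≡∣p∣+∣q∣ [] [] = refl
∣p∪q∣+∣p∩q∣≡∣p∣+∣q∣ (inside ∷ p) (inside ∷ q)
  rewrite +-suc ∣ p ∪ q ∣ ∣ p ∩ q ∣ | +-suc ∣ p ∣ ∣ q ∣ = cong (λ x → suc (suc x)) (∣p∪q∣+∣p∩q∣≡∣p∣+∣q∣ p q)
∣p∪q∣+∣p∩q∣≡∣p∣+∣q∣ (inside ∷ p) (outside ∷ q) = cong suc (∣p∪q∣+∣p∩q∣≡∣p∣+∣q∣ p q)
∣p∪q∣+∣p∩q∣≡∣p∣+∣q∣ (outside ∷ p) (inside ∷ q)
  rewrite +-suc ∣ p ∣ ∣ q ∣ = cong suc (∣p∪q∣+∣p∩q∣≡∣p∣+∣q∣ p q)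
∣p∪q∣+∣p∩q∣≡∣p∣+∣q∣ (outside ∷ p) (outside ∷ q) = ∣p∪q∣+∣p∩q∣≡∣p∣+∣q∣ p q

∪-least : ∀ {n} {p q r : Subset n} → p ⊆ r → q ⊆ r → p ∪ q ⊆ r
∪-least {p = p} {q} p⊆r q⊆r x∈p∪q = [ p⊆r , q⊆r ]′ (x∈p∪q⁻ p q x∈p∪q)

superset-of-size : ∀ {m a} (S : Subset m) → ∣ S ∣ ≤ a → a ≤ m → ∃ λ S′ → S ⊆ S′ × ∣ S′ ∣ ≡ a
superset-of-size [] z≤n z≤n = [] , id , refl
superset-of-size (inside ∷ S) (s≤s ∣S∣≤a) (s≤s a≤m) =
  let S′ , S⊆S′ , ∣S′∣≡a = superset-of-size S ∣S∣≤a a≤m in inside ∷ S′ , s⊆s S⊆S′ , cong suc ∣S′∣≡a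
superset-of-size (outside ∷ S) ∣S∣≤a a≤1+m with m≤n⇒m<n∨m≡n a≤1+m
... | inj₁ (s≤s a≤m) =
  let S′ , S⊆S′ , ∣S′∣≡a = superset-of-size S ∣S∣≤a a≤m in outside ∷ S′ , s⊆s S⊆S′ , ∣S′∣≡a
... | inj₂ refl =
  let S′ , S⊆S′ , ∣S′∣≡m = superset-of-size S (∣p∣≤n S) ≤-refl in inside ∷ S′ , out⊆ S⊆S′ , cong suc ∣S′∣≡m

split-between : ∀ {s t m n c} → s ≤ m → t ≤ n → s + t ≤ c → c ≤ m + n →
  ∃₂ λ a b → s ≤ a × a ≤ m × t ≤ b × b ≤ n × a + b ≡ c
split-between {s} {t} {m} {n} {c} s≤m t≤n s+t≤c c≤m+n with c ≤? m + t
... | yes c≤m+t =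
  c ∸ t , t , m+n≤o⇒m≤o∸n s s+t≤c , m≤n+o⇒m∸n≤o c t (≤-trans c≤m+t (≤-reflexive (+-comm m t))) ,
  ≤-refl , t≤n , m∸n+n≡m (m+n≤o⇒n≤o s s+t≤c)
... | no c≰m+t =
  m , c ∸ m , s≤m , ≤-refl , m+n≤o⇒m≤o∸n t (≤-trans (≤-reflexive (+-comm t m)) m+t≤c) , m≤n+o⇒m∸n≤o c m c≤m+n , m+[n∸m]≡n (m+n≤o⇒m≤o m m+t≤c)
  where
    m+t≤c : m + t ≤ c
    m+t≤c = <⇒≤ (≰⇒> c≰m+t)

supersets-of-total-size : ∀ {m n c} (S : Subset m) (T : Subset n) → size S T ≤ c → c ≤ m + n →
  ∃₂ λ S′ T′ → S ⊆ S′ × T ⊆ T′ × size S′ T′ ≡ c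
supersets-of-total-size S T size≤c c≤m+n =
  let a , b , ∣S∣≤a , a≤m , ∣T∣≤b , b≤n , a+b≡c = split-between (∣p∣≤n S) (∣p∣≤n T) size≤c c≤m+n
      S′ , S⊆S′ , ∣S′∣≡a = superset-of-size S ∣S∣≤a a≤m
      T′ , T⊆T′ , ∣T′∣≡b = superset-of-size T ∣T∣≤b b≤n
  in S′ , T′ , S⊆S′ , T⊆T′ , trans (cong₂ _+_ ∣S′∣≡a ∣T′∣≡b) a+b≡c

size-∪-∩+size-∩-∪ : ∀ {m n} (S S₀ : Subset m) (T T₀ : Subset n) →
  size (S ∪ S₀) (T ∩ T₀) + size (S ∩ S₀) (T ∪ T₀) ≡ size S T + size S₀ T₀
size-∪-∩+size-∩-∪ S S₀ T T₀ = begin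
  (∣ S ∪ S₀ ∣ + ∣ T ∩ T₀ ∣) + (∣ S ∩ S₀ ∣ + ∣ T ∪ T₀ ∣) ≡⟨ interchange +-commutativeSemigroup (∣ S ∪ S₀ ∣) (∣ T ∩ T₀ ∣) (∣ S ∩ S₀ ∣) (∣ T ∪ T₀ ∣) ⟩
  (∣ S ∪ S₀ ∣ + ∣ S ∩ S₀ ∣) + (∣ T ∩ T₀ ∣ + ∣ T ∪ T₀ ∣)
    ≡⟨ cong₂ _+_ (∣p∪q∣+∣p∩q∣≡∣p∣+∣q∣ S S₀) (trans (+-comm ∣ T ∩ T₀ ∣ _) (∣p∪q∣+∣p∩q∣≡∣p∣+∣q∣ T T₀)) ⟩
  (∣ S ∣ + ∣ S₀ ∣) + (∣ T ∣ + ∣ T₀ ∣)  ≡⟨ interchange +-commutativeSemigroup (∣ S ∣) (∣ S₀ ∣) (∣ T ∣) (∣ T₀ ∣) ⟩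
  (∣ S ∣ + ∣ T ∣) + (∣ S₀ ∣ + ∣ T₀ ∣)  ∎
  where open ≡-Reasoning

module _ {m n} (Z : Positions m n) where

  InOptimalCover : Fin m → Set
  InOptimalCover i = ∃₂ λ S₀ T₀ → IsOptimalCover Z S₀ T₀ × i ∈ S₀

  IsCover-mono : ∀ {S S′ T T′} → S ⊆ S′ → T ⊆ T′ → IsCover Z S T → IsCover Z S′ T′
  IsCover-mono S⊆S′ T⊆T′ cover i j z = [ inj₁ ∘ S⊆S′ , inj₂ ∘ T⊆T′ ]′ (cover i j z)

  IsCover-∪-∩ : ∀ {S S₀ T T₀} → IsCover Z S T → IsCover Z S₀ T₀ → IsCover Z (S ∪ S₀) (T ∩ T₀)
  IsCover-∪-∩ cover cover₀ i j z with cover i j z | cover₀ i j z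
  ... | inj₁ i∈S | _         = inj₁ (x∈p∪q⁺ (inj₁ i∈S))
  ... | inj₂ _   | inj₁ i∈S₀ = inj₁ (x∈p∪q⁺ (inj₂ i∈S₀))
  ... | inj₂ j∈T | inj₂ j∈T₀ = inj₂ (x∈p∩q⁺ (j∈T , j∈T₀))

  IsCover-∩-∪ : ∀ {S S₀ T T₀} → IsCover Z S T → IsCover Z S₀ T₀ → IsCover Z (S ∩ S₀) (T ∪ T₀)
  IsCover-∩-∪ cover cover₀ i j z with cover i j z | cover₀ i j z
  ... | inj₂ j∈T | _         = inj₂ (x∈p∪q⁺ (inj₁ j∈T))
  ... | inj₁ _   | inj₂ j∈T₀ = inj₂ (x∈p∪q⁺ (inj₂ j∈T₀))
  ... | inj₁ i∈S | inj₁ i∈S₀ = inj₁ (x∈p∩q⁺ (i∈S , i∈S₀))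

  size-∪-∩-optimal≤ : ∀ {S S₀ T T₀} → IsCover Z S T → IsOptimalCover Z S₀ T₀ →
    size (S ∪ S₀) (T ∩ T₀) ≤ size S T
  size-∪-∩-optimal≤ {S} {S₀} {T} {T₀} cover (cover₀ , optimal) =
    +-cancelʳ-≤ (size (S ∩ S₀) (T ∪ T₀)) (size (S ∪ S₀) (T ∩ T₀)) (size S T) (begin
      size (S ∪ S₀) (T ∩ T₀) + size (S ∩ S₀) (T ∪ T₀) ≡⟨ size-∪-∩+size-∩-∪ S S₀ T T₀ ⟩
      size S T + size S₀ T₀                             ≤⟨ +-monoʳ-≤ (size S T) (optimal _ _ (IsCover-∩-∪ cover cover₀)) ⟩
      size S T + size (S ∩ S₀) (T ∪ T₀)                 ∎)
    where open ≤-Reasoning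

  absorbOptimalRows : ∀ {S T} (P : Subset m) → (∀ {i} → i ∈ P → InOptimalCover i) → IsCover Z S T →
    ∃₂ λ S′ T′ → IsCover Z S′ T′ × size S′ T′ ≤ size S T × S ⊆ S′ × P ⊆ S′
  absorbOptimalRows {S} {T} P P-optimal cover =
    let S′ , T′ , cover′ , size≤ , S⊆S′ , listed⊆S′ = absorbListed (allFin m)
    in S′ , T′ , cover′ , size≤ , S⊆S′ , listed⊆S′ (∈-allFin _)
    where
      absorbListed : (l : List (Fin m)) → ∃₂ λ S′ T′ → IsCover Z S′ T′ × size S′ T′ ≤ size S T × S ⊆ S′ ×
        (∀ {i} → i ∈ₗ l → i ∈ P → i ∈ S′)
      absorbListed [] = S , T , cover , ≤-refl , id , λ ()
      absorbListed (i ∷ l) with absorbListed l | i ∈? P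
      ... | S′ , T′ , cover′ , size≤ , S⊆S′ , listed⊆S′ | no i∉P =
        S′ , T′ , cover′ , size≤ , S⊆S′ , λ { (here refl) i∈P → contradiction i∈P i∉P
                                            ; (there j∈l) → listed⊆S′ j∈l }
      ... | S′ , T′ , cover′ , size≤ , S⊆S′ , listed⊆S′ | yes i∈P =
        let S₀ , T₀ , optimal , i∈S₀ = P-optimal i∈P
        in S′ ∪ S₀ , T′ ∩ T₀ , IsCover-∪-∩ cover′ (proj₁ optimal) ,
           ≤-trans (size-∪-∩-optimal≤ cover′ optimal) size≤ ,
           ⊆-trans S⊆S′ (p⊆p∪q S₀) ,
           λ { (here refl) _ → q⊆p∪q S′ S₀ i∈S₀ ; (there j∈l) j∈P → p⊆p∪q S₀ (listed⊆S′ j∈l j∈P) }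

  IsPartialCover⇒≤m+n : ∀ {c X} → IsPartialCover Z c X → c ≤ m + n
  IsPartialCover⇒≤m+n (S , T , _ , refl , _) = +-mono-≤ (∣p∣≤n S) (∣p∣≤n T)

  IsPartialCover-antimono : ∀ {c X Y} → Y ⊆ X → IsPartialCover Z c X → IsPartialCover Z c Y
  IsPartialCover-antimono Y⊆X (S , T , cover , size≡c , X⊆S) = S , T , cover , size≡c , ⊆-trans Y⊆X X⊆S

  IsPartialCover-fromCover : ∀ {c X S T} → IsCover Z S T → size S T ≤ c → c ≤ m + n → X ⊆ S →
    IsPartialCover Z c X
  IsPartialCover-fromCover {S = S} {T} cover size≤c c≤m+n X⊆S =
    let S′ , T′ , S⊆S′ , T⊆T′ , size≡c = supersets-of-total-size S T size≤c c≤m+n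
    in S′ , T′ , IsCover-mono S⊆S′ T⊆T′ cover , size≡c , ⊆-trans X⊆S S⊆S′

mainTheorem11 : ∀ {m n} (Z : Positions m n) (k : ℕ) → 1 ≤ k → (RZ : Subset m) → IsRZ Z RZ →
    ∀ (X : Subset m) → InI Z k X ⇔ InI Z k (X ∪ RZ)
mainTheorem11 Z k _ RZ isRZ X = mk⇔ absorbRZ (IsPartialCover-antimono Z (p⊆p∪q RZ))
  where
    absorbRZ : InI Z k X → InI Z k (X ∪ RZ)
    absorbRZ X-partial@(S , T , cover , size≡ , X⊆S) =
      let S′ , T′ , cover′ , size≤ , S⊆S′ , RZ⊆S′ = absorbOptimalRows Z RZ (Equivalence.to (isRZ _)) cover
      in IsPartialCover-fromCover Z cover′ (≤-trans size≤ (≤-reflexive size≡))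
           (IsPartialCover⇒≤m+n Z X-partial) (∪-least (⊆-trans X⊆S S⊆S′) RZ⊆S′)
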